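{- Let $m$ and $\ell$ be integers with $1\le\ell<m$, and let $\lambda(i)=\alpha_i$ ($i\in[m]$) be a positional scoring function with $\alpha_1\ge\alpha_2\ge\cdots\ge\alpha_m\ge0$ and $\alpha_1>0$. Then the worst/best-score algorithm for $\ell$-truncated elections (described in the context) is an $r$-approximation algorithm for the positional scoring rule defined by $\lambda$ on $\ell$-truncated instances, where $$r=\frac{\sum_{i=1}^{\ell}\alpha_i}{m\alpha_{\ell+1}+\frac{\alpha_1-\alpha_{\ell+1}}{\alpha_1}\sum_{i=1}^{\ell}\alpha_i};$$ that is, for every election $E$ with $m$ candidates, if $w$ is the candidate returned by the algorithm on $\mathrm{trunc}(E,\ell)$, then $\mathrm{sc}_\lambda(w)/\max_{c\in C}\mathrm{sc}_\lambda(c)\ge r$.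
   Context: An election $E=(V,C)$ has voters $V=\{v_1,\dots,v_n\}$ and $m$ candidates $C$, each voter having a strict linear order over $C$; $\mathrm{pos}_i(c)$ is the position of $c$ in $v_i$'s order. The $\lambda$-score is $\mathrm{sc}_\lambda(c)=\sum_{v_i}\lambda(\mathrm{pos}_i(c))$ and the rule selects candidates of maximal $\lambda$-score. The $\ell$-truncated instance $\mathrm{trunc}(E,\ell)$ contains, for each voter, only the ranking of her top $\ell$ candidates. Algorithm: for each candidate $c$, let $\mathrm{worst}(c)$ be the $\lambda$-score of $c$ obtained when $c$ keeps its position in each voter's top $\ell$ where it appears and is placed at the last position $m$ by every voter not ranking it in the top $\ell$; let $\mathrm{best}(c)$ be its $\lambda$-score when it is instead placed at position $\ell+1$ by every voter not ranking it in the top $\ell$. Let $a$ be a candidate with highest $\mathrm{worst}$ score, $b_1$ a candidate with highest $\mathrm{best}$ score and $b_2$ a candidate with the second highest $\mathrm{best}$ score (highest among candidates other than $b_1$). If $\mathrm{worst}(a)/\mathrm{best}(b_1)\ge\mathrm{worst}(b_1)/\mathrm{best}(b_2)$ the algorithm returns $a$, otherwise it returns $b_1$. -}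

module Defs where

open import Data.Nat as ℕ using (ℕ; zero; suc; _<_; s≤s; z≤n)
open import Data.Nat.Properties as ℕₚ using (<⇒≤; ≤-trans)
open import Data.Fin as Fin using (Fin; fromℕ; fromℕ<; toℕ)
open import Data.Fin.Permutation using (Permutation′; _⟨$⟩ʳ_; _⟨$⟩ˡ_)
open import Data.Integer as ℤ using (ℤ)
open import Data.Maybe using (Maybe; just; nothing)
open import Data.Rational as ℚ using (ℚ; 0ℚ; _+_; _*_; _-_; _÷_; _≤_; _≤?_)
open import Relation.Nullary using (yes; no)
open import Relation.Nullary.Decidable using (⌊_⌋)
open import Data.Bool using (Bool; if_then_else_)

sumℚ : ∀ {n} → (Fin n → ℚ) → ℚ
sumℚ {zero}  f = 0ℚ
sumℚ {suc n} f = f Fin.zero + sumℚ (λ i → f (Fin.suc i))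

-- A vote (strict linear order over the m candidates Fin m) is a permutation
-- σ with  σ ⟨$⟩ʳ p = the candidate at (0-indexed) position p.
Vote : ℕ → Set
Vote m = Permutation′ m

Election : ℕ → ℕ → Set
Election n m = Fin n → Vote m

-- 0-indexed position of candidate c in vote σ  (paper's pos_i(c) = 1 + pos σ c).
pos : ∀ {m} → Vote m → Fin m → Fin m
pos σ c = σ ⟨$⟩ˡ c

-- λ-score; λ is given as a function on 0-indexed positions:  λ i = α_{i+1}.
score : ∀ {n m} → (Fin m → ℚ) → Election n m → Fin m → ℚ
score sf E c = sumℚ (λ i → sf (pos (E i) c))

-- Truncated ballot: the ranking of the top ℓ candidates (j ↦ candidate at position j).
TBallot : ℕ → ℕ → Set
TBallot ℓ m = Fin ℓ → Fin m

trunc : ∀ {n m} (ℓ : ℕ) → ℓ < m → Election n m → Fin n → TBallot ℓ m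
trunc ℓ ℓ<m E i j = E i ⟨$⟩ʳ Fin.inject≤ j (<⇒≤ ℓ<m)

find : ∀ {ℓ m} → TBallot ℓ m → Fin m → Maybe (Fin ℓ)
find {zero}  t c = nothing
find {suc ℓ} t c with t Fin.zero Fin.≟ c
... | yes _ = just Fin.zero
... | no  _ with find (λ j → t (Fin.suc j)) c
...   | just j  = just (Fin.suc j)
...   | nothing = nothing

-- index of 0-indexed position ℓ (paper's position ℓ+1) and of the last position m.
posNext : ∀ {ℓ m} → ℓ < m → Fin m
posNext ℓ<m = fromℕ< ℓ<m

posLast : ∀ {ℓ m} → ℓ < m → Fin m
posLast {m = suc k} _ = fromℕ k

-- contribution of one truncated ballot to c's score if unranked candidates
-- are placed at position `d`.
contrib : ∀ {ℓ m} → ℓ < m → (Fin m → ℚ) → Fin m → TBallot ℓ m → Fin m → ℚ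
contrib ℓ<m sf d t c with find t c
... | just j  = sf (Fin.inject≤ j (<⇒≤ ℓ<m))
... | nothing = sf d

worst : ∀ {n ℓ m} → ℓ < m → (Fin m → ℚ) → (Fin n → TBallot ℓ m) → Fin m → ℚ
worst ℓ<m sf T c = sumℚ (λ i → contrib ℓ<m sf (posLast ℓ<m) (T i) c)

best : ∀ {n ℓ m} → ℓ < m → (Fin m → ℚ) → (Fin n → TBallot ℓ m) → Fin m → ℚ
best ℓ<m sf T c = sumℚ (λ i → contrib ℓ<m sf (posNext ℓ<m) (T i) c)

-- Output of the algorithm given the chosen a, b₁, b₂.
-- worst(a)/best(b₁) ≥ worst(b₁)/best(b₂) is read in cross-multiplied form
-- worst(b₁)·best(b₁) ≤ worst(a)·best(b₂) (all quantities are ≥ 0, best(b₁) > 0;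
-- a vanishing best(b₂) is treated as x/0 = +∞).
output : ∀ {m} → (worstF bestF : Fin m → ℚ) → (a b₁ b₂ : Fin m) → Fin m
output worstF bestF a b₁ b₂ =
  if ⌊ worstF b₁ * bestF b₁ ≤? worstF a * bestF b₂ ⌋ then a else b₁

rNum : ∀ {m} (ℓ : ℕ) → ℓ < m → (Fin m → ℚ) → ℚ
rNum ℓ ℓ<m sf = sumℚ {ℓ} (λ j → sf (Fin.inject≤ j (<⇒≤ ℓ<m)))

rDen : ∀ {m} (ℓ : ℕ) → (ℓ<m : ℓ < m) → (sf : Fin m → ℚ) → .{{_ : ℚ.NonZero (sf (fromℕ< (≤-trans (s≤s z≤n) ℓ<m)))}} → ℚ
rDen {m} ℓ ℓ<m sf =
  (ℤ.+ m ℚ./ 1) * sf (posNext ℓ<m)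
  + ((α₁ - sf (posNext ℓ<m)) ÷ α₁) * rNum ℓ ℓ<m sf
  where α₁ = sf (fromℕ< (≤-trans (s≤s z≤n) ℓ<m))

{-# OPTIONS --safe #-}
-- Write W, S, B for the worst, true and best scores, and r = N/D.  Then
-- W ≤ S ≤ B pointwise.  Each voter gives her top ℓ candidates N in total, so
-- n N ≤ Σ_c W c ≤ m W(a).  A voter ranking c in her top ℓ adds the same amount
-- to W c and B c, any other adds αₘ ≥ 0 and α_{ℓ+1}; hence
-- α₁ B c ≤ (α₁ − α_{ℓ+1}) W c + n α₁ α_{ℓ+1}.  Together with W c ≤ W(a) this
-- gives N B c ≤ D W(a) for every c.  If the algorithm returns a, then
-- N S c ≤ N B(b₁) ≤ D W(a) ≤ D S(a).  If it returns b₁, then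
-- W(a)/B(b₁) < W(b₁)/B(b₂) turns N B(b₁) ≤ D W(a) into N B(b₂) ≤ D W(b₁),
-- which bounds every c ≢ b₁; for c = b₁ itself N ≤ D suffices.
module Submission where

open import Defs
open import Data.Nat as ℕ using (ℕ; s≤s; z≤n)
open import Data.Nat.Properties using (≤-trans)
open import Data.Fin as Fin using (Fin; fromℕ<)
open import Data.Rational as ℚ using (ℚ; 0ℚ; _*_; _≤_; _<_; >-nonZero)
open import Relation.Binary.PropositionalEquality using (_≢_)

open import Algebra.Bundles using (CommutativeRing)
import Algebra.Properties.Semiring.Sum as SemiringSum
open import Data.Empty using (⊥-elim)
open import Data.Fin.Base using (zero; suc; toℕ; inject≤)
import Data.Fin.Properties as Finₚ
open import Data.Fin.Permutation using (Permutation′; _⟨$⟩ʳ_; _⟨$⟩ˡ_; inverseˡ; inverseʳ)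
import Data.Integer.Base as ℤ
import Data.Integer.Properties as ℤₚ
open import Data.Maybe.Base using (just; nothing)
import Data.Nat.Coprimality as Coprimality
import Data.Nat.Properties as ℕₚ
open import Data.Rational.Base using (_+_; _-_; _/_; 1ℚ; mkℚ; nonNegative; positive)
open import Data.Rational.Properties as ℚₚ
  using ( ≤-refl; ≤-reflexive; <⇒≤; ≤-<-trans; ≰⇒>; _≟_
        ; +-mono-≤; +-monoˡ-≤; +-monoʳ-≤; +-identityˡ; +-inverseʳ
        ; *-assoc; *-zeroʳ; *-identityˡ; *-inverseʳ
        ; *-monoˡ-≤-nonNeg; *-monoʳ-≤-nonNeg; *-cancelˡ-≤-pos; *-cancelʳ-≤-pos
        ; *-cancelˡ-<-nonNeg; normalize-coprime; /-cong; +-*-commutativeRing )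
open import Function.Base using (_∘_)
open import Relation.Binary.PropositionalEquality
  using (_≡_; refl; sym; trans; cong; cong₂; subst; subst₂; module ≡-Reasoning)
open import Relation.Nullary using (yes; no)
open import Relation.Nullary.Decidable.Core using (dec⇒maybe)
open import Tactic.RingSolver using (solve-∀)
open import Tactic.RingSolver.Core.AlmostCommutativeRing
  using (AlmostCommutativeRing; fromCommutativeRing)

ℚ-ring : AlmostCommutativeRing _ _
ℚ-ring = fromCommutativeRing +-*-commutativeRing (λ x → dec⇒maybe (0ℚ ≟ x))

*-monoˡ-≤-≥0 : ∀ {r p q} → 0ℚ ≤ r → p ≤ q → r * p ≤ r * q
*-monoˡ-≤-≥0 {r} r≥0 = *-monoˡ-≤-nonNeg r {{nonNegative r≥0}}

*-monoʳ-≤-≥0 : ∀ {r p q} → 0ℚ ≤ r → p ≤ q → p * r ≤ q * r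
*-monoʳ-≤-≥0 {r} r≥0 = *-monoʳ-≤-nonNeg r {{nonNegative r≥0}}

*-cancelˡ-≤->0 : ∀ {r p q} → 0ℚ < r → r * p ≤ r * q → p ≤ q
*-cancelˡ-≤->0 {r} r>0 = *-cancelˡ-≤-pos r {{positive r>0}}

*-cancelʳ-≤->0 : ∀ {r p q} → 0ℚ < r → p * r ≤ q * r → p ≤ q
*-cancelʳ-≤->0 {r} r>0 = *-cancelʳ-≤-pos r {{positive r>0}}

*-≥0 : ∀ {p q} → 0ℚ ≤ p → 0ℚ ≤ q → 0ℚ ≤ p * q
*-≥0 {p} {q} p≥0 q≥0 = subst (_≤ p * q) (*-zeroʳ p) (*-monoˡ-≤-≥0 p≥0 q≥0)

p≤q⇒0≤q-p : ∀ {p q} → p ≤ q → 0ℚ ≤ q - p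
p≤q⇒0≤q-p {p} {q} p≤q = subst (_≤ q - p) (+-inverseʳ p) (+-monoˡ-≤ (ℚ.- p) p≤q)

*>0⇒>0 : ∀ {p q} → 0ℚ ≤ p → 0ℚ < p * q → 0ℚ < q
*>0⇒>0 {p} {q} p≥0 pq>0 =
  *-cancelˡ-<-nonNeg p {{nonNegative p≥0}} (subst (_< p * q) (sym (*-zeroʳ p)) pq>0)

-- N/D ≤ w/x ≤ w′/y, cross-multiplied.
ratio-trans : ∀ {N D x y w w′} → 0ℚ ≤ D → 0ℚ ≤ y → 0ℚ < x →
  N * x ≤ D * w → w * y ≤ w′ * x → N * y ≤ D * w′
ratio-trans {N} {D} {x} {y} {w} {w′} D≥0 y≥0 x>0 Nx≤Dw wy≤w′x =
  *-cancelʳ-≤->0 x>0 (begin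
  N * y * x    ≡⟨ *-swapʳ N y x ⟩
  N * x * y    ≤⟨ *-monoʳ-≤-≥0 y≥0 Nx≤Dw ⟩
  D * w * y    ≡⟨ *-assoc D w y ⟩
  D * (w * y)  ≤⟨ *-monoˡ-≤-≥0 D≥0 wy≤w′x ⟩
  D * (w′ * x) ≡⟨ *-assoc D w′ x ⟨
  D * w′ * x   ∎)
  where
  open ℚₚ.≤-Reasoning
  *-swapʳ : ∀ a b c → a * b * c ≡ a * c * b
  *-swapʳ = solve-∀ ℚ-ring

fromℕ : ℕ → ℚ
fromℕ k = ℤ.+ k / 1

-- The unlabelled step is ℚ addition unfolded on 1ℚ and the normal form of k / 1.
fromℕ-suc : ∀ k → fromℕ (ℕ.suc k) ≡ 1ℚ + fromℕ k
fromℕ-suc k = begin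
  ℤ.+ ℕ.suc k / 1                            ≡⟨ /-cong k+1≡1*1+k*1 refl ⟩
  (ℤ.+ 1 ℤ.* ℤ.+ 1 ℤ.+ ℤ.+ k ℤ.* ℤ.+ 1) / 1  ≡⟨⟩
  1ℚ + mkℚ (ℤ.+ k) 0 k/1-coprime             ≡⟨ cong (1ℚ +_) (normalize-coprime k/1-coprime) ⟨
  1ℚ + fromℕ k                               ∎
  where
  open ≡-Reasoning
  k/1-coprime = Coprimality.sym (Coprimality.1-coprimeTo k)
  k+1≡1*1+k*1 = cong (ℤ._+_ (ℤ.+ 1)) (sym (ℤₚ.*-identityʳ (ℤ.+ k)))

fromℕ≥0 : ∀ k → 0ℚ ≤ fromℕ k
fromℕ≥0 k = ℚₚ.nonNegative⁻¹ (fromℕ k) {{ℚₚ.normalize-nonNeg k 1}}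

module Σ = SemiringSum (CommutativeRing.semiring +-*-commutativeRing)

sumℚ≡sum : ∀ {n} (f : Fin n → ℚ) → sumℚ f ≡ Σ.sum f
sumℚ≡sum {ℕ.zero}  f = refl
sumℚ≡sum {ℕ.suc n} f = cong (f zero +_) (sumℚ≡sum (f ∘ suc))

sumℚ-cong : ∀ {n} {f g : Fin n → ℚ} → (∀ i → f i ≡ g i) → sumℚ f ≡ sumℚ g
sumℚ-cong {ℕ.zero}  f≡g = refl
sumℚ-cong {ℕ.suc n} f≡g = cong₂ _+_ (f≡g zero) (sumℚ-cong (f≡g ∘ suc))

sumℚ-mono-≤ : ∀ {n} {f g : Fin n → ℚ} → (∀ i → f i ≤ g i) → sumℚ f ≤ sumℚ g
sumℚ-mono-≤ {ℕ.zero}  f≤g = ≤-refl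
sumℚ-mono-≤ {ℕ.suc n} f≤g = +-mono-≤ (f≤g zero) (sumℚ-mono-≤ (f≤g ∘ suc))

sumℚ-≥0 : ∀ {n} {f : Fin n → ℚ} → (∀ i → 0ℚ ≤ f i) → 0ℚ ≤ sumℚ f
sumℚ-≥0 {ℕ.zero}  f≥0 = ≤-refl
sumℚ-≥0 {ℕ.suc n} f≥0 = +-mono-≤ (f≥0 zero) (sumℚ-≥0 (f≥0 ∘ suc))

sumℚ-const : ∀ n k → sumℚ {n} (λ _ → k) ≡ fromℕ n * k
sumℚ-const ℕ.zero    k = sym (ℚₚ.*-zeroˡ k)
sumℚ-const (ℕ.suc n) k = begin
  k + sumℚ {n} (λ _ → k)  ≡⟨ cong (k +_) (sumℚ-const n k) ⟩
  k + fromℕ n * k         ≡⟨ distrib k (fromℕ n) ⟩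
  (1ℚ + fromℕ n) * k      ≡⟨ cong (_* k) (fromℕ-suc n) ⟨
  fromℕ (ℕ.suc n) * k     ∎
  where
  open ≡-Reasoning
  distrib : ∀ a b → a + b * a ≡ (1ℚ + b) * a
  distrib = solve-∀ ℚ-ring

*-distribˡ-sumℚ : ∀ {n} k (f : Fin n → ℚ) → k * sumℚ f ≡ sumℚ (λ i → k * f i)
*-distribˡ-sumℚ k f = begin
  k * sumℚ f             ≡⟨ cong (k *_) (sumℚ≡sum f) ⟩
  k * Σ.sum f            ≡⟨ Σ.*-distribˡ-sum k f ⟩
  Σ.sum (λ i → k * f i)  ≡⟨ sumℚ≡sum (λ i → k * f i) ⟨
  sumℚ (λ i → k * f i)   ∎
  where open ≡-Reasoning

sumℚ-distrib-+ : ∀ {n} (f g : Fin n → ℚ) → sumℚ (λ i → f i + g i) ≡ sumℚ f + sumℚ g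
sumℚ-distrib-+ f g = begin
  sumℚ (λ i → f i + g i)  ≡⟨ sumℚ≡sum (λ i → f i + g i) ⟩
  Σ.sum (λ i → f i + g i) ≡⟨ Σ.∑-distrib-+ f g ⟩
  Σ.sum f + Σ.sum g       ≡⟨ cong₂ _+_ (sumℚ≡sum f) (sumℚ≡sum g) ⟨
  sumℚ f + sumℚ g         ∎
  where open ≡-Reasoning

sumℚ-comm : ∀ {m n} (f : Fin m → Fin n → ℚ) →
  sumℚ (λ i → sumℚ (λ j → f i j)) ≡ sumℚ (λ j → sumℚ (λ i → f i j))
sumℚ-comm f = begin
  sumℚ (λ i → sumℚ (λ j → f i j))   ≡⟨ sumℚ-cong (λ i → sumℚ≡sum (f i)) ⟩
  sumℚ (λ i → Σ.sum (λ j → f i j))  ≡⟨ sumℚ≡sum (λ i → Σ.sum (λ j → f i j)) ⟩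
  Σ.sum (λ i → Σ.sum (λ j → f i j)) ≡⟨ Σ.∑-comm f ⟩
  Σ.sum (λ j → Σ.sum (λ i → f i j)) ≡⟨ sumℚ≡sum (λ j → Σ.sum (λ i → f i j)) ⟨
  sumℚ (λ j → Σ.sum (λ i → f i j))  ≡⟨ sumℚ-cong (λ j → sumℚ≡sum (λ i → f i j)) ⟨
  sumℚ (λ j → sumℚ (λ i → f i j))   ∎
  where open ≡-Reasoning

sumℚ-permute : ∀ {n} (f : Fin n → ℚ) (π : Permutation′ n) →
  sumℚ f ≡ sumℚ (f ∘ (π ⟨$⟩ʳ_))
sumℚ-permute f π = begin
  sumℚ f                ≡⟨ sumℚ≡sum f ⟩
  Σ.sum f               ≡⟨ Σ.∑-permute f π ⟩
  Σ.sum (f ∘ (π ⟨$⟩ʳ_)) ≡⟨ sumℚ≡sum (f ∘ (π ⟨$⟩ʳ_)) ⟨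
  sumℚ (f ∘ (π ⟨$⟩ʳ_))  ∎
  where open ≡-Reasoning

sumℚ-inject≤-≤ : ∀ {ℓ m} (ℓ≤m : ℓ ℕ.≤ m) {f : Fin m → ℚ} → (∀ i → 0ℚ ≤ f i) →
  sumℚ (λ j → f (inject≤ j ℓ≤m)) ≤ sumℚ f
sumℚ-inject≤-≤ {ℕ.zero}  _         f≥0 = sumℚ-≥0 f≥0
sumℚ-inject≤-≤ {ℕ.suc ℓ} (s≤s ℓ≤m) {f} f≥0 =
  +-monoʳ-≤ (f zero) (sumℚ-inject≤-≤ ℓ≤m (f≥0 ∘ suc))

find-just : ∀ {ℓ m} (t : TBallot ℓ m) c j → find t c ≡ just j → t j ≡ c
find-just {ℕ.suc ℓ} t c j eq with t zero Fin.≟ c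
find-just {ℕ.suc ℓ} t c .zero refl | yes t₀≡c = t₀≡c
... | no _ with find (t ∘ suc) c in eq′
find-just {ℕ.suc ℓ} t c .(suc j) refl | no _ | just j = find-just (t ∘ suc) c j eq′
find-just {ℕ.suc ℓ} t c j () | no _ | nothing

find-nothing : ∀ {ℓ m} (t : TBallot ℓ m) c → find t c ≡ nothing → ∀ j → t j ≢ c
find-nothing {ℕ.suc ℓ} t c eq j with t zero Fin.≟ c
find-nothing {ℕ.suc ℓ} t c () j | yes _
... | no t₀≢c with find (t ∘ suc) c in eq′
find-nothing {ℕ.suc ℓ} t c () j | no _ | just _
find-nothing {ℕ.suc ℓ} t c refl zero | no t₀≢c | nothing = t₀≢c
find-nothing {ℕ.suc ℓ} t c refl (suc j) | no _ | nothing = find-nothing (t ∘ suc) c eq′ j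

≤posLast : ∀ {ℓ m} (ℓ<m : ℓ ℕ.< m) (p : Fin m) → p Fin.≤ posLast ℓ<m
≤posLast {m = ℕ.suc k} _ p = subst (toℕ p ℕ.≤_) (sym (Finₚ.toℕ-fromℕ k)) (Finₚ.toℕ≤pred[n] p)

top : ∀ {ℓ m} → ℓ ℕ.< m → Vote m → TBallot ℓ m
top ℓ<m σ j = σ ⟨$⟩ʳ inject≤ j (ℕₚ.<⇒≤ ℓ<m)

module _ {ℓ m} (ℓ<m : ℓ ℕ.< m) (σ : Vote m) where

  find-top-just⇒pos : ∀ c j → find (top ℓ<m σ) c ≡ just j →
    pos σ c ≡ inject≤ j (ℕₚ.<⇒≤ ℓ<m)
  find-top-just⇒pos c j eq =
    trans (cong (σ ⟨$⟩ˡ_) (sym (find-just (top ℓ<m σ) c j eq))) (inverseˡ σ)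

  find-top-nothing⇒ℓ≤pos : ∀ c → find (top ℓ<m σ) c ≡ nothing → ℓ ℕ.≤ toℕ (pos σ c)
  find-top-nothing⇒ℓ≤pos c eq with ℓ ℕ.≤? toℕ (pos σ c)
  ... | yes ℓ≤pos = ℓ≤pos
  ... | no ℓ≰pos = ⊥-elim (find-nothing (top ℓ<m σ) c eq j top-j≡c)
    where
    pos<ℓ : toℕ (pos σ c) ℕ.< ℓ
    pos<ℓ = ℕₚ.≰⇒> ℓ≰pos
    j : Fin ℓ
    j = fromℕ< pos<ℓ
    j≡pos : inject≤ j (ℕₚ.<⇒≤ ℓ<m) ≡ pos σ c
    j≡pos = Finₚ.toℕ-injective (trans (Finₚ.toℕ-inject≤ j _) (Finₚ.toℕ-fromℕ< pos<ℓ))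
    top-j≡c : top ℓ<m σ j ≡ c
    top-j≡c = trans (cong (σ ⟨$⟩ʳ_) j≡pos) (inverseʳ σ)

  contrib-top : ∀ (sf : Fin m → ℚ) d j →
    contrib ℓ<m sf d (top ℓ<m σ) (top ℓ<m σ j) ≡ sf (inject≤ j (ℕₚ.<⇒≤ ℓ<m))
  contrib-top sf d j with find (top ℓ<m σ) (top ℓ<m σ j) in eq
  ... | just j′ = cong sf (trans (sym (find-top-just⇒pos _ j′ eq)) (inverseˡ σ))
  ... | nothing = ⊥-elim (find-nothing (top ℓ<m σ) _ eq j refl)

module Bounds {ℓ m} (ℓ<m : ℓ ℕ.< m) (α : Fin m → ℚ)
  (α-antitone : ∀ (i j : Fin m) → i Fin.≤ j → α j ≤ α i)
  (αₘ≥0 : 0ℚ ≤ α (posLast ℓ<m)) where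

  α₁ β : ℚ
  α₁ = α (fromℕ< (≤-trans (s≤s z≤n) ℓ<m))
  β  = α (posNext ℓ<m)

  α≤α₁ : ∀ p → α p ≤ α₁
  α≤α₁ p = α-antitone _ p (subst (ℕ._≤ toℕ p) (sym (Finₚ.toℕ-fromℕ< _)) z≤n)

  αₘ≤α : ∀ p → α (posLast ℓ<m) ≤ α p
  αₘ≤α p = α-antitone p _ (≤posLast ℓ<m p)

  α≥0 : ∀ p → 0ℚ ≤ α p
  α≥0 p = ℚₚ.≤-trans αₘ≥0 (αₘ≤α p)

  worst₁ best₁ : Vote m → Fin m → ℚ
  worst₁ σ = contrib ℓ<m α (posLast ℓ<m) (top ℓ<m σ)
  best₁  σ = contrib ℓ<m α (posNext ℓ<m) (top ℓ<m σ)

  worst₁≤α-pos : ∀ σ c → worst₁ σ c ≤ α (pos σ c)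
  worst₁≤α-pos σ c with find (top ℓ<m σ) c in eq
  ... | just j  = ≤-reflexive (cong α (sym (find-top-just⇒pos ℓ<m σ c j eq)))
  ... | nothing = αₘ≤α (pos σ c)

  α-pos≤best₁ : ∀ σ c → α (pos σ c) ≤ best₁ σ c
  α-pos≤best₁ σ c with find (top ℓ<m σ) c in eq
  ... | just j  = ≤-reflexive (cong α (find-top-just⇒pos ℓ<m σ c j eq))
  ... | nothing = α-antitone _ _ (subst (ℕ._≤ toℕ (pos σ c)) (sym (Finₚ.toℕ-fromℕ< ℓ<m))
                                        (find-top-nothing⇒ℓ≤pos ℓ<m σ c eq))

  worst₁≥0 : ∀ σ c → 0ℚ ≤ worst₁ σ c
  worst₁≥0 σ c with find (top ℓ<m σ) c
  ... | just j  = α≥0 _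
  ... | nothing = αₘ≥0

  -- If σ ranks c in its top ℓ, both sides see the same value x ≤ α₁;
  -- otherwise best₁ σ c = β and worst₁ σ c = αₘ ≥ 0.
  α₁*best₁≤ : ∀ σ c → α₁ * best₁ σ c ≤ (α₁ - β) * worst₁ σ c + α₁ * β
  α₁*best₁≤ σ c with find (top ℓ<m σ) c
  ... | just j = begin
      α₁ * x                     ≡⟨ split α₁ β x ⟩
      (α₁ - β) * x + β * x       ≤⟨ +-monoʳ-≤ ((α₁ - β) * x) (*-monoˡ-≤-≥0 (α≥0 _) (α≤α₁ x-pos)) ⟩
      (α₁ - β) * x + β * α₁      ≡⟨ cong ((α₁ - β) * x +_) (ℚₚ.*-comm β α₁) ⟩
      (α₁ - β) * x + α₁ * β      ∎
    where
    open ℚₚ.≤-Reasoning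
    x-pos = inject≤ j (ℕₚ.<⇒≤ ℓ<m)
    x = α x-pos
    split : ∀ a b c → a * c ≡ (a - b) * c + b * c
    split = solve-∀ ℚ-ring
  ... | nothing = subst (_≤ (α₁ - β) * α (posLast ℓ<m) + α₁ * β) (+-identityˡ (α₁ * β))
                    (+-monoˡ-≤ (α₁ * β) (*-≥0 (p≤q⇒0≤q-p (α≤α₁ _)) αₘ≥0))

  rNum≤sum-worst₁ : ∀ σ → rNum ℓ ℓ<m α ≤ sumℚ (worst₁ σ)
  rNum≤sum-worst₁ σ = begin
    rNum ℓ ℓ<m α                         ≡⟨ sumℚ-cong (contrib-top ℓ<m σ α (posLast ℓ<m)) ⟨
    sumℚ (λ j → worst₁ σ (top ℓ<m σ j))  ≤⟨ sumℚ-inject≤-≤ (ℕₚ.<⇒≤ ℓ<m) (worst₁≥0 σ ∘ (σ ⟨$⟩ʳ_)) ⟩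
    sumℚ (worst₁ σ ∘ (σ ⟨$⟩ʳ_))          ≡⟨ sumℚ-permute (worst₁ σ) σ ⟨
    sumℚ (worst₁ σ)                      ∎
    where open ℚₚ.≤-Reasoning

  N : ℚ
  N = rNum ℓ ℓ<m α

  N≥0 : 0ℚ ≤ N
  N≥0 = sumℚ-≥0 {ℓ} (λ j → α≥0 (inject≤ j (ℕₚ.<⇒≤ ℓ<m)))

  N≤m*α₁ : N ≤ fromℕ m * α₁
  N≤m*α₁ = begin
    N                      ≤⟨ sumℚ-inject≤-≤ (ℕₚ.<⇒≤ ℓ<m) α≥0 ⟩
    sumℚ α                 ≤⟨ sumℚ-mono-≤ α≤α₁ ⟩
    sumℚ {m} (λ _ → α₁)    ≡⟨ sumℚ-const m α₁ ⟩
    fromℕ m * α₁           ∎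
    where open ℚₚ.≤-Reasoning

  module _ (α₁>0 : 0ℚ < α₁) where

    D : ℚ
    D = rDen ℓ ℓ<m α {{>-nonZero α₁>0}}

    α₁*D : α₁ * D ≡ α₁ * fromℕ m * β + (α₁ - β) * N
    α₁*D = begin
      α₁ * D                            ≡⟨ distrib α₁ (fromℕ m) β α₁⁻¹ N ⟩
      α₁ * fromℕ m * β + α₁ * α₁⁻¹ * X  ≡⟨ cong (λ u → α₁ * fromℕ m * β + u * X) (*-inverseʳ α₁) ⟩
      α₁ * fromℕ m * β + 1ℚ * X         ≡⟨ cong (α₁ * fromℕ m * β +_) (*-identityˡ X) ⟩
      α₁ * fromℕ m * β + X              ∎
      where
      open ≡-Reasoning
      instance _ = >-nonZero α₁>0
      α₁⁻¹ = ℚ.1/ α₁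
      X = (α₁ - β) * N
      distrib : ∀ a k b a⁻¹ s →
        a * (k * b + (a - b) * a⁻¹ * s) ≡ a * k * b + a * a⁻¹ * ((a - b) * s)
      distrib = solve-∀ ℚ-ring

    D≥0 : 0ℚ ≤ D
    D≥0 = *-cancelˡ-≤->0 α₁>0 (subst₂ _≤_ (sym (*-zeroʳ α₁)) (sym α₁*D)
      (+-mono-≤ (*-≥0 (*-≥0 (<⇒≤ α₁>0) (fromℕ≥0 m)) (α≥0 _))
                (*-≥0 (p≤q⇒0≤q-p (α≤α₁ _)) N≥0)))

    N≤D : N ≤ D
    N≤D = *-cancelˡ-≤->0 α₁>0 (begin
      α₁ * N                            ≡⟨ split α₁ β N ⟩
      (α₁ - β) * N + β * N              ≤⟨ +-monoʳ-≤ ((α₁ - β) * N) (*-monoˡ-≤-≥0 (α≥0 _) N≤m*α₁) ⟩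
      (α₁ - β) * N + β * (fromℕ m * α₁) ≡⟨ rearrange α₁ β N (fromℕ m) ⟩
      α₁ * fromℕ m * β + (α₁ - β) * N   ≡⟨ α₁*D ⟨
      α₁ * D                            ∎)
      where
      open ℚₚ.≤-Reasoning
      split : ∀ a b s → a * s ≡ (a - b) * s + b * s
      split = solve-∀ ℚ-ring
      rearrange : ∀ a b s k → (a - b) * s + b * (k * a) ≡ a * k * b + (a - b) * s
      rearrange = solve-∀ ℚ-ring

  module Scores {n} (E : Election n m) where

    W B S : Fin m → ℚ
    W = worst ℓ<m α (trunc ℓ ℓ<m E)
    B = best ℓ<m α (trunc ℓ ℓ<m E)
    S = score α E

    W≤S : ∀ c → W c ≤ S c
    W≤S c = sumℚ-mono-≤ (λ i → worst₁≤α-pos (E i) c)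

    S≤B : ∀ c → S c ≤ B c
    S≤B c = sumℚ-mono-≤ (λ i → α-pos≤best₁ (E i) c)

    W≥0 : ∀ c → 0ℚ ≤ W c
    W≥0 c = sumℚ-≥0 (λ i → worst₁≥0 (E i) c)

    S≥0 : ∀ c → 0ℚ ≤ S c
    S≥0 c = ℚₚ.≤-trans (W≥0 c) (W≤S c)

    B≥0 : ∀ c → 0ℚ ≤ B c
    B≥0 c = ℚₚ.≤-trans (S≥0 c) (S≤B c)

    n*N≤m*W-max : ∀ a → (∀ c → W c ≤ W a) → fromℕ n * N ≤ fromℕ m * W a
    n*N≤m*W-max a a-max = begin
      fromℕ n * N                       ≡⟨ sumℚ-const n N ⟨
      sumℚ {n} (λ _ → N)                ≤⟨ sumℚ-mono-≤ (λ i → rNum≤sum-worst₁ (E i)) ⟩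
      sumℚ (λ i → sumℚ (worst₁ (E i)))  ≡⟨ sumℚ-comm (λ i → worst₁ (E i)) ⟩
      sumℚ W                            ≤⟨ sumℚ-mono-≤ a-max ⟩
      sumℚ {m} (λ _ → W a)              ≡⟨ sumℚ-const m (W a) ⟩
      fromℕ m * W a                     ∎
      where open ℚₚ.≤-Reasoning

    α₁*B≤ : ∀ c → α₁ * B c ≤ (α₁ - β) * W c + fromℕ n * (α₁ * β)
    α₁*B≤ c = begin
      α₁ * sumℚ b                                    ≡⟨ *-distribˡ-sumℚ α₁ b ⟩
      sumℚ (λ i → α₁ * b i)                          ≤⟨ sumℚ-mono-≤ (λ i → α₁*best₁≤ (E i) c) ⟩
      sumℚ (λ i → (α₁ - β) * w i + α₁ * β)
        ≡⟨ sumℚ-distrib-+ (λ i → (α₁ - β) * w i) (λ _ → α₁ * β) ⟩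
      sumℚ (λ i → (α₁ - β) * w i) + sumℚ {n} (λ _ → α₁ * β)
        ≡⟨ cong₂ _+_ (sym (*-distribˡ-sumℚ (α₁ - β) w)) (sumℚ-const n (α₁ * β)) ⟩
      (α₁ - β) * sumℚ w + fromℕ n * (α₁ * β)         ∎
      where
      open ℚₚ.≤-Reasoning
      w b : Fin n → ℚ
      w i = worst₁ (E i) c
      b i = best₁ (E i) c

    N*B≤D*W-max : (α₁>0 : 0ℚ < α₁) → ∀ a → (∀ c → W c ≤ W a) →
      ∀ b → N * B b ≤ D α₁>0 * W a
    N*B≤D*W-max α₁>0 a a-max b = *-cancelˡ-≤->0 α₁>0 (begin
      α₁ * (N * B b)                                 ≡⟨ *-swapˡ α₁ N (B b) ⟩
      N * (α₁ * B b)                                 ≤⟨ *-monoˡ-≤-≥0 N≥0 α₁B≤ ⟩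
      N * ((α₁ - β) * W a + fromℕ n * (α₁ * β))      ≡⟨ expand N α₁ β (W a) (fromℕ n) ⟩
      (α₁ - β) * N * W a + β * α₁ * (fromℕ n * N)
        ≤⟨ +-monoʳ-≤ ((α₁ - β) * N * W a) (*-monoˡ-≤-≥0 βα₁≥0 (n*N≤m*W-max a a-max)) ⟩
      (α₁ - β) * N * W a + β * α₁ * (fromℕ m * W a)  ≡⟨ collect α₁ β N (W a) (fromℕ m) ⟩
      (α₁ * fromℕ m * β + (α₁ - β) * N) * W a        ≡⟨ cong (_* W a) (α₁*D α₁>0) ⟨
      α₁ * D α₁>0 * W a                              ≡⟨ *-assoc α₁ (D α₁>0) (W a) ⟩
      α₁ * (D α₁>0 * W a)                            ∎)
      where
      open ℚₚ.≤-Reasoning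
      α₁B≤ : α₁ * B b ≤ (α₁ - β) * W a + fromℕ n * (α₁ * β)
      α₁B≤ = ℚₚ.≤-trans (α₁*B≤ b)
        (+-monoˡ-≤ _ (*-monoˡ-≤-≥0 (p≤q⇒0≤q-p (α≤α₁ _)) (a-max b)))
      βα₁≥0 : 0ℚ ≤ β * α₁
      βα₁≥0 = *-≥0 (α≥0 _) (<⇒≤ α₁>0)
      *-swapˡ : ∀ a b c → a * (b * c) ≡ b * (a * c)
      *-swapˡ = solve-∀ ℚ-ring
      expand : ∀ s a b w k →
        s * ((a - b) * w + k * (a * b)) ≡ (a - b) * s * w + b * a * (k * s)
      expand = solve-∀ ℚ-ring
      collect : ∀ a b s w k →
        (a - b) * s * w + b * a * (k * w) ≡ (a * k * b + (a - b) * s) * w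
      collect = solve-∀ ℚ-ring

theorem3 : (n m ℓ : ℕ) → 1 ℕ.≤ ℓ → (ℓ<m : ℓ ℕ.< m) →
    (α : Fin m → ℚ) →
    (∀ (i j : Fin m) → i Fin.≤ j → α j ≤ α i) →
    0ℚ ≤ α (posLast ℓ<m) →
    (α₁>0 : 0ℚ < α (fromℕ< (≤-trans (s≤s z≤n) ℓ<m))) →
    (E : Election n m) →
    (a b₁ b₂ : Fin m) →
    (∀ c → worst ℓ<m α (trunc ℓ ℓ<m E) c ≤ worst ℓ<m α (trunc ℓ ℓ<m E) a) →
    (∀ c → best ℓ<m α (trunc ℓ ℓ<m E) c ≤ best ℓ<m α (trunc ℓ ℓ<m E) b₁) →
    b₂ ≢ b₁ →
    (∀ c → c ≢ b₁ → best ℓ<m α (trunc ℓ ℓ<m E) c ≤ best ℓ<m α (trunc ℓ ℓ<m E) b₂) →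
    ∀ (c : Fin m) →
      rNum ℓ ℓ<m α * score α E c
        ≤ rDen ℓ ℓ<m α {{>-nonZero α₁>0}}
          * score α E (output (worst ℓ<m α (trunc ℓ ℓ<m E)) (best ℓ<m α (trunc ℓ ℓ<m E)) a b₁ b₂)
theorem3 n m ℓ _ ℓ<m α α-antitone αₘ≥0 α₁>0 E a b₁ b₂ a-max b₁-max _ b₂-max c = approximation
  where
  open Bounds ℓ<m α α-antitone αₘ≥0
  open Scores E
  open ℚₚ.≤-Reasoning
  N*B≤D*Wa : ∀ b → N * B b ≤ D α₁>0 * W a
  N*B≤D*Wa = N*B≤D*W-max α₁>0 a a-max
  approximation : N * S c ≤ D α₁>0 * S (output W B a b₁ b₂)
  approximation with W b₁ * B b₁ ℚ.≤? W a * B b₂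
  ... | yes _ = begin
    N * S c         ≤⟨ *-monoˡ-≤-≥0 N≥0 (ℚₚ.≤-trans (S≤B c) (b₁-max c)) ⟩
    N * B b₁        ≤⟨ N*B≤D*Wa b₁ ⟩
    D α₁>0 * W a    ≤⟨ *-monoˡ-≤-≥0 (D≥0 α₁>0) (W≤S a) ⟩
    D α₁>0 * S a    ∎
  ... | no a-loses with c Fin.≟ b₁
  ...   | yes refl = *-monoʳ-≤-≥0 (S≥0 b₁) (N≤D α₁>0)
  ...   | no c≢b₁ = begin
    N * S c         ≤⟨ *-monoˡ-≤-≥0 N≥0 (ℚₚ.≤-trans (S≤B c) (b₂-max c c≢b₁)) ⟩
    N * B b₂        ≤⟨ ratio-trans {N = N} (D≥0 α₁>0) (B≥0 b₂) Bb₁>0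
                                      (N*B≤D*Wa b₁) (<⇒≤ Wa*Bb₂<Wb₁*Bb₁) ⟩
    D α₁>0 * W b₁   ≤⟨ *-monoˡ-≤-≥0 (D≥0 α₁>0) (W≤S b₁) ⟩
    D α₁>0 * S b₁   ∎
    where
    Wa*Bb₂<Wb₁*Bb₁ : W a * B b₂ < W b₁ * B b₁
    Wa*Bb₂<Wb₁*Bb₁ = ≰⇒> a-loses
    Bb₁>0 : 0ℚ < B b₁
    Bb₁>0 = *>0⇒>0 (W≥0 b₁) (≤-<-trans (*-≥0 (W≥0 a) (B≥0 b₂)) Wa*Bb₂<Wb₁*Bb₁)
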